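{- The axiomatization $\mathbf{OML}$ is sound for $\mathcal{L}^{\Box\circ}$: every formula of $\mathcal{L}^{\Box\circ}$ derivable in $\mathbf{OML}$ is valid.
   Context: Fix a non-empty countable set $P$ of atoms and a non-empty finite set $A$ of agents. $\mathcal{L}^{\Box\circ}$: $\varphi ::= p \mid \neg\varphi \mid (\varphi\wedge\varphi) \mid \Box_a\varphi \mid [\circ]\varphi$; $\mathcal{L}_0$ is the propositional fragment. Abbreviations: usual Boolean connectives, $\Diamond_a\varphi:=\neg\Box_a\neg\varphi$. A model is $M=(S,R,V)$ with $S$ non-empty countable, $R_a\subseteq S\times S$ ($a\in A$), $V:S\to\mathcal{P}(P)$. The mutual factual ignorance model is $M^\circ=(S^\circ,R^\circ,V^\circ)$ with $S^\circ=\mathcal{P}(P)$, $R^\circ_a=S^\circ\times S^\circ$ for all $a$, $V^\circ(s)=s$. Semantics: $M_s\models p$ iff $p\in V(s)$; Boolean clauses as usual; $M_s\models\Box_a\varphi$ iff $M_t\models\varphi$ for all $(s,t)\in R_a$; $M_s\models[\circ]\varphi$ iff $M^\circ_{V(s)}\models\varphi$. Valid: true at every pointed model (with countable domain). $\mathbf{OML}$ consists of the following axiom schemes and rules over $\mathcal{L}^{\Box\circ}$: Prop: substitution instances of propositional tautologies; K: $\Box_a(\varphi\to\psi)\to(\Box_a\varphi\to\Box_a\psi)$; MP: from $\varphi\to\psi$ and $\varphi$ infer $\psi$; N: from $\varphi$ infer $\Box_a\varphi$; RE: from $\chi\leftrightarrow\psi$ infer $\varphi[\chi/p]\leftrightarrow\varphi[\psi/p]$;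 O1: $[\circ]\varphi_0\leftrightarrow\varphi_0$ for $\varphi_0\in\mathcal{L}_0$; OT: $[\circ](\Box_a\varphi\to\varphi)$; O5: $[\circ](\Diamond_a\varphi\to\Box_a\Diamond_a\varphi)$; OExch: $[\circ](\Box_a\varphi\to\Box_b\varphi)$; OFull: $[\circ]\Diamond_a\varphi$ where $\varphi$ is of the form $\bigwedge_{p\in Q_1}p\wedge\bigwedge_{p\in Q_2}\neg p$ with finite $Q_1,Q_2\subseteq P$, $Q_1\cap Q_2=\emptyset$; ODual: $[\circ]\neg\varphi\leftrightarrow\neg[\circ]\varphi$; ODisj: $[\circ](\varphi\vee\psi)\leftrightarrow([\circ]\varphi\vee[\circ]\psi)$; OMP: from $[\circ](\varphi\to\psi)$ and $[\circ]\varphi$ infer $[\circ]\psi$; ON: from $[\circ]\varphi$ infer $[\circ]\Box_a\varphi$. -}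

module Defs where

open import Data.Nat using (ℕ)
open import Data.Nat.Properties using () renaming (_≟_ to _≟ℕ_)
open import Data.Bool using (Bool; true; false; not; _∧_)
open import Data.Fin using (Fin)
open import Data.List using (List; []; _∷_; map; _++_; foldr)
open import Data.List.Membership.Propositional using (_∈_; _∉_)
open import Data.Product using (Σ; _×_; _,_; ∃)
open import Data.Empty using (⊥)
open import Function.Bundles using (_↔_)
open import Function.Definitions using (Injective)
open import Relation.Binary.PropositionalEquality using (_≡_; refl; cong)
open import Relation.Binary.Definitions using (DecidableEquality)
open import Relation.Nullary using (yes; no; ¬_)

Countable : Set → Set
Countable X = Σ (X → ℕ) (λ f → Injective _≡_ _≡_ f)

FiniteNonEmpty : Set → Set
FiniteNonEmpty X = Σ ℕ (λ n → X ↔ Fin (Data.Nat.suc n))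

countable-≟ : {X : Set} → Countable X → DecidableEquality X
countable-≟ (f , inj) x y with f x ≟ℕ f y
... | yes e = yes (inj e)
... | no ne = no (λ e → ne (cong f e))

data Form (P A : Set) : Set where
  atom : P → Form P A
  ~_   : Form P A → Form P A
  _∧'_ : Form P A → Form P A → Form P A
  □    : A → Form P A → Form P A
  [○]  : Form P A → Form P A

infix  9 ~_
infixr 7 _∧'_


module _ {P A : Set} where

  _⇒_ : Form P A → Form P A → Form P A
  φ ⇒ ψ = ~ (φ ∧' ~ ψ)

  _∨'_ : Form P A → Form P A → Form P A
  φ ∨' ψ = ~ (~ φ ∧' ~ ψ)

  _⇔_ : Form P A → Form P A → Form P A
  φ ⇔ ψ = (φ ⇒ ψ) ∧' (ψ ⇒ φ)

  ◇ : A → Form P A → Form P A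
  ◇ a φ = ~ (□ a (~ φ))

  data IsL₀ : Form P A → Set where
    atom : (p : P) → IsL₀ (atom p)
    neg  : {φ : Form P A} → IsL₀ φ → IsL₀ (~ φ)
    conj : {φ ψ : Form P A} → IsL₀ φ → IsL₀ ψ → IsL₀ (φ ∧' ψ)

  sub : DecidableEquality P → Form P A → P → Form P A → Form P A
  sub eq χ p (atom q) with eq q p
  ... | yes _ = χ
  ... | no  _ = atom q
  sub eq χ p (~ φ)     = ~ (sub eq χ p φ)
  sub eq χ p (φ ∧' ψ)  = sub eq χ p φ ∧' sub eq χ p ψ
  sub eq χ p (□ a φ)   = □ a (sub eq χ p φ)
  sub eq χ p ([○] φ)   = [○] (sub eq χ p φ)

data PForm : Set where
  var  : ℕ → PForm
  neg  : PForm → PForm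
  conj : PForm → PForm → PForm

evalP : (ℕ → Bool) → PForm → Bool
evalP v (var n)    = v n
evalP v (neg θ)    = not (evalP v θ)
evalP v (conj θ η) = evalP v θ ∧ evalP v η

Tautology : PForm → Set
Tautology θ = (v : ℕ → Bool) → evalP v θ ≡ true

instP : {P A : Set} → (ℕ → Form P A) → PForm → Form P A
instP σ (var n)    = σ n
instP σ (neg θ)    = ~ (instP σ θ)
instP σ (conj θ η) = instP σ θ ∧' instP σ η

TautInstance : {P A : Set} → Form P A → Set
TautInstance {P} {A} φ =
  Σ PForm (λ θ → Σ (ℕ → Form P A) (λ σ → Tautology θ × (instP σ θ ≡ φ)))

-- The axiom system OML.  `eq` is decidable equality on atoms (used by RE),
-- `p₀` is an atom used to define ⊤ := ~(p₀ ∧ ~p₀) (the empty conjunction).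

module _ {P A : Set} where

  ⊤' : P → Form P A
  ⊤' p₀ = ~ (atom p₀ ∧' ~ atom p₀)

  literalConj : P → List P → List P → Form P A
  literalConj p₀ Q₁ Q₂ =
    foldr _∧'_ (⊤' p₀) (map atom Q₁ ++ map (λ q → ~ atom q) Q₂)

  data OML (eq : DecidableEquality P) (p₀ : P) : Form P A → Set where
    Prop  : {φ : Form P A} → TautInstance φ → OML eq p₀ φ
    K     : (a : A) (φ ψ : Form P A) →
            OML eq p₀ (□ a (φ ⇒ ψ) ⇒ (□ a φ ⇒ □ a ψ))
    MP    : {φ ψ : Form P A} → OML eq p₀ (φ ⇒ ψ) → OML eq p₀ φ → OML eq p₀ ψ
    N     : (a : A) {φ : Form P A} → OML eq p₀ φ → OML eq p₀ (□ a φ)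
    RE    : {χ ψ : Form P A} (φ : Form P A) (p : P) →
            OML eq p₀ (χ ⇔ ψ) → OML eq p₀ (sub eq χ p φ ⇔ sub eq ψ p φ)
    O1    : (φ : Form P A) → IsL₀ φ → OML eq p₀ ([○] φ ⇔ φ)
    OT    : (a : A) (φ : Form P A) → OML eq p₀ ([○] (□ a φ ⇒ φ))
    O5    : (a : A) (φ : Form P A) → OML eq p₀ ([○] (◇ a φ ⇒ □ a (◇ a φ)))
    OExch : (a b : A) (φ : Form P A) → OML eq p₀ ([○] (□ a φ ⇒ □ b φ))
    OFull : (a : A) (Q₁ Q₂ : List P) →
            ((p : P) → p ∈ Q₁ → p ∉ Q₂) →
            OML eq p₀ ([○] (◇ a (literalConj p₀ Q₁ Q₂)))
    ODual : (φ : Form P A) → OML eq p₀ (([○] (~ φ)) ⇔ (~ ([○] φ)))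
    ODisj : (φ ψ : Form P A) → OML eq p₀ ([○] (φ ∨' ψ) ⇔ ([○] φ ∨' [○] ψ))
    OMP   : {φ ψ : Form P A} → OML eq p₀ ([○] (φ ⇒ ψ)) → OML eq p₀ ([○] φ) →
            OML eq p₀ ([○] ψ)
    ON    : (a : A) {φ : Form P A} → OML eq p₀ ([○] φ) → OML eq p₀ ([○] (□ a φ))

record Structure (P A : Set) : Set₁ where
  field
    S : Set
    R : A → S → S → Set
    V : S → P → Bool
open Structure public

M° : (P A : Set) → Structure P A
M° P A = record { S = P → Bool ; R = λ _ _ _ → Data.Unit.⊤ ; V = λ s → s }
  where import Data.Unit

_,_⊨_ : {P A : Set} (M : Structure P A) → S M → Form P A → Set
M , s ⊨ atom p   = V M s p ≡ true
M , s ⊨ (~ φ)    = ¬ (M , s ⊨ φ)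
M , s ⊨ (φ ∧' ψ) = (M , s ⊨ φ) × (M , s ⊨ ψ)
M , s ⊨ □ a φ    = (t : S M) → R M a s t → M , t ⊨ φ
_,_⊨_ {P} {A} M s ([○] φ) = M° P A , V M s ⊨ φ

-- a model: a structure with a non-empty (witnessed by pointedness) countable domain
record Model (P A : Set) : Set₁ where
  field
    structure : Structure P A
    countable : Countable (S structure)
open Model public

Valid : {P A : Set} → Form P A → Set₁
Valid {P} {A} φ = (M : Model P A) (s : S (structure M)) → structure M , s ⊨ φ

{-# OPTIONS --safe #-}
-- Satisfaction is stable under double negation, because atoms are Boolean.  Hence a
-- formula of the shape φ ⇒ ψ may be used as an implication, and a substitution
-- instance of a classical tautology holds: refuting it would need only finitely many
-- of its atoms to be decided, and excluded middle for finitely many propositions is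
-- irrefutable.  The [○]-axioms hold because M° has the universal relation and
-- contains every valuation.
module Submission where

open import Defs renaming (_⇔_ to _⇔'_)
open import Data.Bool using (Bool; true; false; not; T)
open import Data.Bool.Properties using (T-≡; T-∧) renaming (_≟_ to _≟𝔹_)
open import Data.List using (List; []; _∷_; _++_; map; foldr)
open import Data.List.Membership.Propositional using (_∈_; _∉_)
import Data.List.Membership.DecPropositional as DecMembership
open import Data.List.Relation.Unary.All using (All; []; _∷_)
import Data.List.Relation.Unary.All as All
open import Data.List.Relation.Unary.All.Properties using (++⁺; ++⁻; map⁺)
open import Data.Nat using (ℕ) renaming (_≟_ to _≟ℕ_)
open import Data.Product using (Σ-syntax; _×_; _,_; proj₁; proj₂)
open import Data.Product.Function.NonDependent.Propositional using (_×-⇔_)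
open import Data.Unit using (tt)
open import Effect.Monad using (RawMonad)
open import Function using (_∘_; id; const)
open import Function.Bundles using (_⇔_; mk⇔; Equivalence)
open import Function.Construct.Identity using (⇔-id)
open import Function.Properties.Equivalence using () renaming (sym to ⇔-sym; trans to ⇔-trans)
open import Function.Related.TypeIsomorphisms using (¬-cong-⇔)
open import Level using (0ℓ)
open import Relation.Binary.Definitions using (DecidableEquality)
open import Relation.Binary.PropositionalEquality using (_≡_; _≢_; refl; sym; trans)
open import Relation.Nullary using (¬_; Dec; yes; no; does)
open import Relation.Nullary.Decidable using (decidable-stable; ¬¬-excluded-middle)
open import Relation.Nullary.Negation using (Stable; negated-stable; ¬¬-map; ¬¬-Monad; contradiction)

open Equivalence using (to; from)
open RawMonad (¬¬-Monad {a = 0ℓ}) using (pure; _<$>_; _<*>_)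

⇒-intro : {X Y : Set} → (X → Y) → ¬ (X × ¬ Y)
⇒-intro f (x , ¬y) = ¬y (f x)

⇒-elim : {X Y : Set} → Stable Y → ¬ (X × ¬ Y) → X → Y
⇒-elim stable h x = stable (λ ¬y → h (x , ¬y))

⇔-intro : {X Y : Set} → X ⇔ Y → ¬ (X × ¬ Y) × ¬ (Y × ¬ X)
⇔-intro X⇔Y = ⇒-intro (to X⇔Y) , ⇒-intro (from X⇔Y)

⇔-elim : {X Y : Set} → Stable X → Stable Y → ¬ (X × ¬ Y) × ¬ (Y × ¬ X) → X ⇔ Y
⇔-elim stableX stableY (X⇒Y , Y⇒X) = mk⇔ (⇒-elim stableY X⇒Y) (⇒-elim stableX Y⇒X)

T-not : ∀ {b} → T (not b) ⇔ (¬ T b)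
T-not {true}  = mk⇔ (λ ()) (λ ¬t → ¬t tt)
T-not {false} = mk⇔ (λ _ ()) (const tt)

T-does : {X : Set} (x? : Dec X) → X ⇔ T (does x?)
T-does (yes x) = mk⇔ (const tt) (const x)
T-does (no ¬x) = mk⇔ ¬x (λ ())

¬¬-decide-all : {X : Set} (I : X → Set) (xs : List X) → ¬ ¬ All (Dec ∘ I) xs
¬¬-decide-all I []       = pure []
¬¬-decide-all I (x ∷ xs) = _∷_ <$> ¬¬-excluded-middle <*> ¬¬-decide-all I xs

Agrees : (ℕ → Set) → (ℕ → Bool) → List ℕ → Set
Agrees I v = All (λ n → I n ⇔ T (v n))

¬¬-agreeing-valuation : (I : ℕ → Set) (ns : List ℕ) → ¬ ¬ (Σ[ v ∈ (ℕ → Bool) ] Agrees I v ns)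
¬¬-agreeing-valuation I ns =
  ¬¬-map (λ ds → valuation ds , All.tabulate (agrees ds)) (¬¬-decide-all I ns)
  where
  open DecMembership _≟ℕ_ using (_∈?_)

  valuation : All (Dec ∘ I) ns → ℕ → Bool
  valuation ds n with n ∈? ns
  ... | yes n∈ns = does (All.lookup ds n∈ns)
  ... | no _     = false

  agrees : (ds : All (Dec ∘ I) ns) {n : ℕ} → n ∈ ns → I n ⇔ T (valuation ds n)
  agrees ds {n} n∈ns with n ∈? ns
  ... | yes n∈ns′ = T-does (All.lookup ds n∈ns′)
  ... | no n∉ns   = contradiction n∈ns n∉ns

vars : PForm → List ℕ
vars (var n)    = n ∷ []
vars (neg θ)    = vars θ
vars (conj θ η) = vars θ ++ vars η

module _ {P A : Set} where

  ⊨-stable : (M : Structure P A) (s : S M) (φ : Form P A) → Stable (M , s ⊨ φ)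
  ⊨-stable M s (atom p)  = decidable-stable (V M s p ≟𝔹 true)
  ⊨-stable M s (~ φ)     = negated-stable
  ⊨-stable M s (φ ∧' ψ)  = λ ¬¬φψ →
    ⊨-stable M s φ (¬¬-map proj₁ ¬¬φψ) , ⊨-stable M s ψ (¬¬-map proj₂ ¬¬φψ)
  ⊨-stable M s (□ a φ)   = λ ¬¬□φ t sRt → ⊨-stable M t φ (¬¬-map (λ □φ → □φ t sRt) ¬¬□φ)
  ⊨-stable M s ([○] φ)   = ⊨-stable (M° P A) (V M s) φ

  module _ (M : Structure P A) (s : S M) (σ : ℕ → Form P A) where

    instP-⇔-evalP : (v : ℕ → Bool) (θ : PForm) → Agrees (λ n → M , s ⊨ σ n) v (vars θ) →
                    (M , s ⊨ instP σ θ) ⇔ T (evalP v θ)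
    instP-⇔-evalP v (var n)    (agree ∷ []) = agree
    instP-⇔-evalP v (neg θ)    agree = ⇔-trans (¬-cong-⇔ (instP-⇔-evalP v θ agree)) (⇔-sym T-not)
    instP-⇔-evalP v (conj θ η) agree =
      ⇔-trans (instP-⇔-evalP v θ agreeθ ×-⇔ instP-⇔-evalP v η agreeη) (⇔-sym T-∧)
      where
      agreeθ : Agrees (λ n → M , s ⊨ σ n) v (vars θ)
      agreeθ = proj₁ (++⁻ (vars θ) agree)
      agreeη : Agrees (λ n → M , s ⊨ σ n) v (vars η)
      agreeη = proj₂ (++⁻ (vars θ) agree)

    tautology-instance-holds : (θ : PForm) → Tautology θ → M , s ⊨ instP σ θ
    tautology-instance-holds θ taut = ⊨-stable M s (instP σ θ) λ ¬holds →
      ¬¬-agreeing-valuation (λ n → M , s ⊨ σ n) (vars θ) λ (v , agree) →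
        ¬holds (from (instP-⇔-evalP v θ agree) (from T-≡ (taut v)))

  Equivalent : Form P A → Form P A → Set₁
  Equivalent φ ψ = (M : Structure P A) (s : S M) → (M , s ⊨ φ) ⇔ (M , s ⊨ ψ)

  sub-cong : (eq : DecidableEquality P) (p : P) (φ : Form P A) {χ ψ : Form P A} →
             Equivalent χ ψ → Equivalent (sub eq χ p φ) (sub eq ψ p φ)
  sub-cong eq p (atom q) χ≃ψ M s with eq q p
  ... | yes _ = χ≃ψ M s
  ... | no _  = ⇔-id _
  sub-cong eq p (~ φ)    χ≃ψ M s = ¬-cong-⇔ (sub-cong eq p φ χ≃ψ M s)
  sub-cong eq p (φ ∧' ψ) χ≃ψ M s = sub-cong eq p φ χ≃ψ M s ×-⇔ sub-cong eq p ψ χ≃ψ M s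
  sub-cong eq p (□ a φ)  χ≃ψ M s =
    mk⇔ (λ □φ t sRt → to (sub-cong eq p φ χ≃ψ M t) (□φ t sRt))
        (λ □φ t sRt → from (sub-cong eq p φ χ≃ψ M t) (□φ t sRt))
  sub-cong eq p ([○] φ)  χ≃ψ M s = sub-cong eq p φ χ≃ψ (M° P A) (V M s)

  L₀-local : {φ : Form P A} → IsL₀ φ → (M M′ : Structure P A) (s : S M) (t : S M′) →
             (∀ p → V M s p ≡ V M′ t p) → (M , s ⊨ φ) ⇔ (M′ , t ⊨ φ)
  L₀-local (atom p)   M M′ s t same = mk⇔ (trans (sym (same p))) (trans (same p))
  L₀-local (neg l)    M M′ s t same = ¬-cong-⇔ (L₀-local l M M′ s t same)
  L₀-local (conj l k) M M′ s t same = L₀-local l M M′ s t same ×-⇔ L₀-local k M M′ s t same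

  ⊨-foldr-∧' : (M : Structure P A) (s : S M) {z : Form P A} (φs : List (Form P A)) →
               All (M , s ⊨_) φs → M , s ⊨ z → M , s ⊨ foldr _∧'_ z φs
  ⊨-foldr-∧' M s []       []         z = z
  ⊨-foldr-∧' M s (φ ∷ φs) (sφ ∷ sφs) z = sφ , ⊨-foldr-∧' M s φs sφs z

  ⊨-literalConj : (M : Structure P A) (s : S M) (p₀ : P) (Q₁ Q₂ : List P) →
                  All (λ q → V M s q ≡ true) Q₁ → All (λ q → V M s q ≢ true) Q₂ →
                  M , s ⊨ literalConj p₀ Q₁ Q₂
  ⊨-literalConj M s p₀ Q₁ Q₂ true-on-Q₁ false-on-Q₂ =
    ⊨-foldr-∧' M s (map atom Q₁ ++ map (~_ ∘ atom) Q₂)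
      (++⁺ (map⁺ true-on-Q₁) (map⁺ false-on-Q₂))
      (λ (x , ¬x) → ¬x x)

  literalConj-satisfiable : (eq : DecidableEquality P) (p₀ : P) (Q₁ Q₂ : List P) →
                            (∀ p → p ∈ Q₁ → p ∉ Q₂) →
                            Σ[ t ∈ (P → Bool) ] M° P A , t ⊨ literalConj p₀ Q₁ Q₂
  literalConj-satisfiable eq p₀ Q₁ Q₂ disjoint =
    t , ⊨-literalConj (M° P A) t p₀ Q₁ Q₂
          (All.tabulate (to t-true))
          (All.tabulate λ q∈Q₂ tq≡true → disjoint _ (from t-true tq≡true) q∈Q₂)
    where
    open DecMembership eq using (_∈?_)

    t : P → Bool
    t q = does (q ∈? Q₁)

    t-true : ∀ {q} → q ∈ Q₁ ⇔ (t q ≡ true)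
    t-true {q} = ⇔-trans (T-does (q ∈? Q₁)) T-≡

  OML-sound : {eq : DecidableEquality P} {p₀ : P} {φ : Form P A} → OML eq p₀ φ →
              (M : Structure P A) (s : S M) → M , s ⊨ φ
  OML-sound (Prop (θ , σ , taut , refl)) M s = tautology-instance-holds M s σ θ taut
  OML-sound (K a φ ψ) M s = ⇒-intro λ □φ⇒ψ → ⇒-intro λ □φ t sRt →
    ⇒-elim (⊨-stable M t ψ) (□φ⇒ψ t sRt) (□φ t sRt)
  OML-sound (MP {ψ = ψ} d e) M s = ⇒-elim (⊨-stable M s ψ) (OML-sound d M s) (OML-sound e M s)
  OML-sound (N a d) M s = λ t _ → OML-sound d M t
  OML-sound {eq} (RE {χ} {ψ} φ p d) M s = ⇔-intro (sub-cong eq p φ χ≃ψ M s)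
    where
    χ≃ψ : Equivalent χ ψ
    χ≃ψ M s = ⇔-elim (⊨-stable M s χ) (⊨-stable M s ψ) (OML-sound d M s)
  OML-sound (O1 φ l) M s = ⇔-intro (L₀-local l (M° P A) M (V M s) s λ _ → refl)
  OML-sound (OT a φ) M s = ⇒-intro λ □φ → □φ (V M s) tt
  OML-sound (O5 a φ) M s = ⇒-intro λ ◇φ _ _ → ◇φ
  OML-sound (OExch a b φ) M s = ⇒-intro id
  OML-sound {eq} {p₀} (OFull a Q₁ Q₂ disjoint) M s □¬φ =
    □¬φ _ tt (proj₂ (literalConj-satisfiable eq p₀ Q₁ Q₂ disjoint))
  -- [○] only moves the point of evaluation, so it commutes with ~ and ∨' definitionally.
  OML-sound (ODual φ) M s = ⇔-intro (⇔-id _)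
  OML-sound (ODisj φ ψ) M s = ⇔-intro (⇔-id _)
  OML-sound (OMP {ψ = ψ} d e) M s =
    ⇒-elim (⊨-stable (M° P A) (V M s) ψ) (OML-sound d M s) (OML-sound e M s)
  OML-sound (ON a d) M s = λ t _ → OML-sound d (M° P A) t

proposition6 : {P A : Set} (cP : Countable P) (p₀ : P) (fA : FiniteNonEmpty A) (φ : Form P A) → OML (countable-≟ cP) p₀ φ → Valid φ
proposition6 _ _ _ _ d M s = OML-sound d (structure M) s
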